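{- Let $(P,\le,{}^*,0,1)$ be a pseudocomplemented poset such that $(P^*,\le)$ is a complete lattice having the property that for each subset $B$ of $P^*$ the infimum of $B$ in $(P,\le)$ exists and coincides with the infimum of $B$ in $(P^*,\le)$, and let $A\subseteq P$. Then there exists some $b\in P$ with $b^\perp=A^\perp$.
   Context: A bounded poset $(P,\le,0,1)$ is pseudocomplemented if for each $x\in P$ there exists a greatest element $y\in P$ such that the infimum $x\wedge y$ exists and equals $0$; it is denoted $x^*$. $P^*:=\{x^*\mid x\in P\}$. The orthogonality relation is $x\perp y$ iff $y\le x^*$. For $A\subseteq P$, $A^\perp:=\{x\in P\mid x\perp y\text{ for all }y\in A\}$, and $b^\perp:=\{b\}^\perp$. -}

module Defs where

open import Level using (Level; _⊔_)
open import Relation.Binary.Bundles using (Poset)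
open import Relation.Unary using (Pred; _∈_; _⊆_)
open import Data.Product using (Σ; ∃; _×_; _,_)
open import Function.Bundles using (_⇔_)

module _ {c ℓ₁ ℓ₂ : Level} (P : Poset c ℓ₁ ℓ₂) where
  open Poset P renaming (Carrier to X)

  -- subsets of P (at a level large enough to contain images of subsets)
  Subset : Set _
  Subset = Pred X (c ⊔ ℓ₁ ⊔ ℓ₂)

  IsLowerBound : {ℓ : Level} → Pred X ℓ → X → Set _
  IsLowerBound S m = ∀ x → x ∈ S → m ≤ x

  IsUpperBound : {ℓ : Level} → Pred X ℓ → X → Set _
  IsUpperBound S m = ∀ x → x ∈ S → x ≤ m

  IsInfimum : {ℓ : Level} → Pred X ℓ → X → Set _
  IsInfimum S m = IsLowerBound S m × (∀ l → IsLowerBound S l → l ≤ m)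

  IsInfimumIn : {ℓ ℓ' : Level} → Pred X ℓ' → Pred X ℓ → X → Set _
  IsInfimumIn Q S m =
    m ∈ Q × IsLowerBound S m × (∀ l → l ∈ Q → IsLowerBound S l → l ≤ m)

  IsSupremumIn : {ℓ ℓ' : Level} → Pred X ℓ' → Pred X ℓ → X → Set _
  IsSupremumIn Q S m =
    m ∈ Q × IsUpperBound S m × (∀ u → u ∈ Q → IsUpperBound S u → m ≤ u)

  IsMeet : X → X → X → Set _
  IsMeet x y m = (m ≤ x × m ≤ y) × (∀ l → l ≤ x → l ≤ y → l ≤ m)

  record IsBoundedPseudocomplemented (_* : X → X) (𝟘 𝟙 : X) : Set (c ⊔ ℓ₁ ⊔ ℓ₂) where
    field
      bottom   : ∀ x → 𝟘 ≤ x
      top      : ∀ x → x ≤ 𝟙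
      meet-*   : ∀ x → IsMeet x (x *) 𝟘
      greatest : ∀ x y → IsMeet x y 𝟘 → y ≤ x *

  module _ (_* : X → X) where

    P* : Pred X (c ⊔ ℓ₁)
    P* z = Σ X λ x → z ≈ x *

    _⊥_ : X → X → Set ℓ₂
    x ⊥ y = y ≤ x *

    _^⊥ : {ℓ : Level} → Pred X ℓ → Pred X (c ⊔ ℓ ⊔ ℓ₂)
    (A ^⊥) x = ∀ y → y ∈ A → x ⊥ y

    _ᵉ^⊥ : X → Pred X ℓ₂
    (b ᵉ^⊥) x = x ⊥ b

    record StarCompleteCondition : Set (Level.suc (c ⊔ ℓ₁ ⊔ ℓ₂)) where
      field
        sup-in-P*  : (B : Subset) → B ⊆ P* → ∃ λ s → IsSupremumIn P* B s
        inf-in-P*  : (B : Subset) → B ⊆ P* → ∃ λ m → IsInfimumIn P* B m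
        inf-in-P   : (B : Subset) → B ⊆ P* → ∃ λ m → IsInfimum B m
        inf-agree  : (B : Subset) → B ⊆ P* → ∀ m m' →
                     IsInfimum B m → IsInfimumIn P* B m' → m ≈ m'

module Submission where

open import Defs
open import Level using (Level)
open import Relation.Binary.Bundles using (Poset)
open import Relation.Unary using (Pred; _∈_; _⊆_)
open import Data.Product using (∃; Σ; _×_; _,_)
open import Function.Bundles using (_⇔_; mk⇔)
open import Function.Construct.Composition using (_⇔-∘_)
open import Function.Construct.Symmetry using (⇔-sym)

-- A^⊥ is the set of lower bounds of {y* | y ∈ A}; since that set lies in P*,
-- it has an infimum of the form b*, and the lower bounds of b* form b^⊥.

module _ {c ℓ₁ ℓ₂ : Level} (P : Poset c ℓ₁ ℓ₂) where
  open Poset P renaming (Carrier to X)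

  lowerBound⇔≤infimum : ∀ {ℓ} {S : Pred X ℓ} {m} → IsInfimum P S m →
                        ∀ x → IsLowerBound P S x ⇔ x ≤ m
  lowerBound⇔≤infimum (m-lb , m-glb) x =
    mk⇔ (m-glb x) (λ x≤m y y∈S → trans x≤m (m-lb y y∈S))

  isMeet-comm : ∀ {x y m} → IsMeet P x y m → IsMeet P y x m
  isMeet-comm ((m≤x , m≤y) , m-glb) = (m≤y , m≤x) , λ l l≤y l≤x → m-glb l l≤x l≤y

  isInfimum-respʳ-≈ : ∀ {ℓ} {S : Pred X ℓ} {m m′} → m ≈ m′ →
                      IsInfimum P S m → IsInfimum P S m′
  isInfimum-respʳ-≈ m≈m′ (m-lb , m-glb) =
    (λ y y∈S → ≤-respˡ-≈ m≈m′ (m-lb y y∈S)) ,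
    (λ l l-lb → ≤-respʳ-≈ m≈m′ (m-glb l l-lb))

  module _ (_* : X → X) where

    *-image : Subset P → Subset P
    *-image A w = Σ X λ y → y ∈ A × w ≈ y *

    *-image⊆P* : (A : Subset P) → *-image A ⊆ P* P _*
    *-image⊆P* A (y , _ , w≈y*) = y , w≈y*

    infimum-of-P*-subset : StarCompleteCondition P _* →
                           (B : Subset P) → B ⊆ P* P _* →
                           ∃ λ b → IsInfimum P B (b *)
    infimum-of-P*-subset sc B B⊆P* =
      let m , m-inf = inf-in-P B B⊆P*
          m′ , m′-inf = inf-in-P* B B⊆P*
          b , m′≈b* = Σ.proj₁ m′-inf
      in b , isInfimum-respʳ-≈ (Eq.trans (inf-agree B B⊆P* m m′ m-inf m′-inf) m′≈b*) m-inf
      where open StarCompleteCondition sc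

    module _ {𝟘 𝟙 : X} (pc : IsBoundedPseudocomplemented P _* 𝟘 𝟙) where
      open IsBoundedPseudocomplemented pc

      ≤-** : ∀ x → x ≤ (x *) *
      ≤-** x = greatest (x *) x (isMeet-comm (meet-* x))

      *-antitone : ∀ {x y} → x ≤ y → y * ≤ x *
      *-antitone {x} {y} x≤y =
        greatest x (y *) ((bottom x , bottom (y *)) ,
                          λ l l≤x l≤y* → Σ.proj₂ (meet-* y) l (trans l≤x x≤y) l≤y*)

      ⊥-sym : ∀ {x y} → _⊥_ P _* x y → _⊥_ P _* y x
      ⊥-sym {x} y≤x* = trans (≤-** x) (*-antitone y≤x*)

      ᵉ^⊥⇔≤* : ∀ b x → x ∈ _ᵉ^⊥ P _* b ⇔ x ≤ b *
      ᵉ^⊥⇔≤* b x = mk⇔ ⊥-sym ⊥-sym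

      ^⊥⇔lowerBound-*-image : ∀ (A : Subset P) x →
                              x ∈ _^⊥ P _* A ⇔ IsLowerBound P (*-image A) x
      ^⊥⇔lowerBound-*-image A x = mk⇔
        (λ x∈A^⊥ w (y , y∈A , w≈y*) → ≤-respʳ-≈ (Eq.sym w≈y*) (⊥-sym (x∈A^⊥ y y∈A)))
        (λ x-lb y y∈A → ⊥-sym (x-lb (y *) (y , y∈A , Eq.refl)))

lemma4 : {c ℓ₁ ℓ₂ : Level} (P : Poset c ℓ₁ ℓ₂)
    (_* : Poset.Carrier P → Poset.Carrier P) (𝟘 𝟙 : Poset.Carrier P) →
    IsBoundedPseudocomplemented P _* 𝟘 𝟙 →
    StarCompleteCondition P _* →
    (A : Subset P) →
    ∃ λ b → ∀ x → (x ∈ _ᵉ^⊥ P _* b) ⇔ (x ∈ _^⊥ P _* A)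
lemma4 P _* 𝟘 𝟙 pc sc A
  with b , b*-inf ← infimum-of-P*-subset P _* sc (*-image P _* A) (*-image⊆P* P _* A)
  = b , λ x →
    ⇔-sym (^⊥⇔lowerBound-*-image P _* pc A x)
      ⇔-∘ (⇔-sym (lowerBound⇔≤infimum P b*-inf x)
      ⇔-∘ ᵉ^⊥⇔≤* P _* pc b x)
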